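{- Let $n \in \mathbb{N}$ with $n \geq 2$ and let $\mathcal{U} \subseteq \mathcal{P}([n])$ be an up-set with $\#\mathcal{U} \leq 2^{n-1}$. Let $C = 1 + e^{ -1}$ and let $t \in \mathbb{N}$ with $t \geq \frac{Cn}{\log_2 n}$. Then for any sets $A_1, \dots, A_t \in \mathcal{U}$ there are indices $i < j$ with $A_i \cap A_j \neq \emptyset$.
   Context: $[n] = \{1,\dots,n\}$, $\mathcal{P}([n])$ its power set, $\#X$ the cardinality. An up-set is a family $\mathcal{U} \subseteq \mathcal{P}([n])$ such that $A \in \mathcal{U}$ and $A \subseteq B \subseteq [n]$ imply $B \in \mathcal{U}$. -}

module Defs where

open import Data.Nat using (ℕ; zero; suc; _+_; _*_; _∸_; _^_; _≤_; _<_; _!)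
open import Data.Product using (Σ; ∃; _×_)
open import Data.Sum using (_⊎_)
open import Data.List using (List; length)
open import Data.List.Membership.Propositional using (_∈_)
open import Data.List.Relation.Unary.Unique.Propositional using (Unique)
open import Data.Fin.Subset using (Subset; _⊆_)
open import Relation.Nullary using (¬_)

-- A family of subsets of [n], given as a duplicate-free list (so #𝒰 = length).
record Family (n : ℕ) : Set where
  field
    members : List (Subset n)
    unique  : Unique members

open Family public

card : ∀ {n} → Family n → ℕ
card 𝒰 = length (members 𝒰)

IsUpSet : ∀ {n} → Family n → Set
IsUpSet 𝒰 = ∀ A B → A ∈ members 𝒰 → A ⊆ B → B ∈ members 𝒰

-- Euler's number e = Σ_k 1/k!.  P N = N! · Σ_{k ≤ N} 1/k!  (a natural number).
P : ℕ → ℕ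
P zero    = 1
P (suc N) = suc N * P N + 1

-- "e < p / q" (p, q natural): since 0 < e - S_N < 2/(N+1)! where S_N = P N / N!,
-- e < p/q  iff  ∃ N, S_N + 2/(N+1)! < p/q  iff  ∃ N, q·((N+1)·P N + 2) < p·(N+1)!.
eLess : ℕ → ℕ → Set
eLess p q = ∃ λ N → q * (suc N * P N + 2) < p * (suc N) !

-- "t · log₂ n < (1 + e⁻¹) · n", expressed through a rational a/b strictly in between:
--   t·log₂ n < a/b   iff  n^(t·b) < 2^a
--   a/b < n + n/e    iff  a ≤ b·n, or (b·n < a and e < b·n / (a − b·n)).
BelowThreshold : ℕ → ℕ → Set
BelowThreshold n t =
  Σ ℕ λ a → Σ ℕ λ b →
    (0 < b) × (n ^ (t * b) < 2 ^ a) ×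
    ((a ≤ b * n) ⊎ ((b * n < a) × eLess (b * n) (a ∸ b * n)))

-- For n ≥ 2 (so log₂ n > 0):  t ≥ C n / log₂ n  with C = 1 + e⁻¹
--   iff  t · log₂ n ≥ C n  iff  ¬ (t · log₂ n < C n).
AboveThreshold : ℕ → ℕ → Set
AboveThreshold n t = ¬ BelowThreshold n t

module Submission where

-- Suppose A₁, …, Aₜ ∈ 𝒰 were pairwise disjoint, of sizes s₁, …, sₜ. The sets B ⊆ [n] containing
-- no Aᵢ number 2ⁿ ∏ (1 − 2^−sᵢ), and none of them lies in the up-set 𝒰 of size at most 2ⁿ⁻¹;
-- so ∏ (1 − 2^−sᵢ) ≥ 1/2, while Σ sᵢ ≤ n.
-- Bernoulli's inequality 1 − 2^−s ≤ (1 − 2^−K)^(2^(K−s)) turns the product bound into a linear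
-- one: the weights 2^(K−sᵢ) (over sᵢ ≤ K) add up to some R with (1 − 2^−K)^R ≥ 1/2, hence R < 2^K,
-- and 2^(K−sᵢ) ≥ 2ᵉ (k + 2 − sᵢ) whenever K = e + k + 1, so 2ᵉ (k + 2) t ≤ 2ᵉ n + R.
-- With K = ⌊log₂ t⌋ + 1 this gives n ≥ t ⌊log₂ t⌋, enough for t ≥ 2¹³; for smaller t one uses K = 14,
-- where R ≤ 11356, and a certificate for each t that is checked by evaluation. Either way
-- t log₂ n < (547/400) n, and 547/400 < 1 + e⁻¹ contradicts the threshold.

open import Defs

module Powers where

  open import Data.Nat
  open import Data.Nat.Properties
  open import Data.Nat.Tactic.RingSolver using (solve-∀)
  open import Algebra.Properties.CommutativeSemigroup *-commutativeSemigroup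
    using (x∙yz≈y∙xz; xy∙z≈y∙xz; x∙yz≈z∙xy; x∙yz≈z∙yx)
  open import Data.Product using (∃; _×_; _,_)
  open import Relation.Binary.PropositionalEquality
  open import Relation.Nullary using (yes; no; contradiction)

  ^-distribʳ-* : ∀ m n o → (m * n) ^ o ≡ m ^ o * n ^ o
  ^-distribʳ-* m n zero    = refl
  ^-distribʳ-* m n (suc o) = begin
    m * n * (m * n) ^ o      ≡⟨ cong (m * n *_) (^-distribʳ-* m n o) ⟩
    m * n * (m ^ o * n ^ o)  ≡⟨ [m*n]*[o*p]≡[m*o]*[n*p] m n (m ^ o) (n ^ o) ⟩
    m * m ^ o * (n * n ^ o)  ∎
    where open ≡-Reasoning

  ^-cancelˡ-< : ∀ n .{{_ : NonZero n}} {x y} → x ^ n < y ^ n → x < y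
  ^-cancelˡ-< n {x} {y} xⁿ<yⁿ with x <? y
  ... | yes x<y = x<y
  ... | no  x≮y = contradiction xⁿ<yⁿ (≤⇒≯ (^-monoˡ-≤ n (≮⇒≥ x≮y)))

  n<2^n : ∀ n → n < 2 ^ n
  n<2^n zero    = z<s
  n<2^n (suc n) = begin-strict
    suc n                ≤⟨ n<2^n n ⟩
    2 ^ n                <⟨ m<m+n (2 ^ n) (≤-trans (m^n>0 2 n) (m≤m+n (2 ^ n) 0)) ⟩
    2 ^ n + (2 ^ n + 0)  ∎
    where open ≤-Reasoning

  log₂-bracket : ∀ t → ∃ λ L → 2 ^ L ≤ suc t × suc t < 2 ^ suc L
  log₂-bracket zero    = 0 , s≤s z≤n , s≤s (s≤s z≤n)
  log₂-bracket (suc t) with log₂-bracket t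
  ... | L , lo , hi with suc (suc t) <? 2 ^ suc L
  ...   | yes hi′ = L , m≤n⇒m≤1+n lo , hi′
  ...   | no  hi′ = suc L , ≮⇒≥ hi′ , ≤-<-trans hi (^-monoʳ-< 2 (s≤s (s≤s z≤n)) (n<1+n (suc L)))

  bernoulli⁻ : ∀ r q → suc (r + q) ^ r * suc q ≤ suc (r + q) * (r + q) ^ r
  bernoulli⁻ zero    q = ≤-reflexive (*-comm 1 (suc q))
  bernoulli⁻ (suc r) q = begin
    D * D ^ r * suc q          ≡⟨ xy∙z≈y∙xz D (D ^ r) (suc q) ⟩
    D ^ r * (D * suc q)        ≤⟨ *-monoʳ-≤ (D ^ r) step ⟩
    D ^ r * (d * suc (suc q))  ≡⟨ x∙yz≈y∙xz (D ^ r) d (suc (suc q)) ⟩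
    d * (D ^ r * suc (suc q))  ≤⟨ *-monoʳ-≤ d ih ⟩
    d * (D * d ^ r)            ≡⟨ x∙yz≈y∙xz d D (d ^ r) ⟩
    D * (d * d ^ r)            ∎
    where
    open ≤-Reasoning
    d = suc (r + q)
    D = suc d
    ih : D ^ r * suc (suc q) ≤ D * d ^ r
    ih = subst (λ x → suc x ^ r * suc (suc q) ≤ suc x * x ^ r) (+-suc r q) (bernoulli⁻ r (suc q))
    step : D * suc q ≤ d * suc (suc q)
    step = begin
      suc q + d * suc q  ≤⟨ +-monoˡ-≤ (d * suc q) (s≤s (m≤n+m q r)) ⟩
      d + d * suc q      ≡⟨ *-suc d (suc q) ⟨
      d * suc (suc q)    ∎

  bernoulli⁺ : ∀ p R → p ^ R * (p + R) ≤ p * suc p ^ R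
  bernoulli⁺ p zero    = ≤-reflexive (trans (*-identityˡ (p + 0)) (trans (+-identityʳ p) (sym (*-identityʳ p))))
  bernoulli⁺ p (suc R) = begin
    p * p ^ R * (p + suc R)    ≡⟨ xy∙z≈y∙xz p (p ^ R) (p + suc R) ⟩
    p ^ R * (p * (p + suc R))  ≤⟨ *-monoʳ-≤ (p ^ R) step ⟩
    p ^ R * ((p + R) * suc p)  ≡⟨ x∙yz≈z∙xy (p ^ R) (p + R) (suc p) ⟩
    suc p * (p ^ R * (p + R))  ≤⟨ *-monoʳ-≤ (suc p) (bernoulli⁺ p R) ⟩
    suc p * (p * suc p ^ R)    ≡⟨ x∙yz≈y∙xz (suc p) p (suc p ^ R) ⟩
    p * (suc p * suc p ^ R)    ∎
    where
    open ≤-Reasoning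
    split : ∀ p R → p * (p + suc R) ≡ p * (p + R) + p
    split = solve-∀
    merge : ∀ p R → p * (p + R) + (p + R) ≡ (p + R) * suc p
    merge = solve-∀
    step : p * (p + suc R) ≤ (p + R) * suc p
    step = begin
      p * (p + suc R)        ≡⟨ split p R ⟩
      p * (p + R) + p        ≤⟨ +-monoʳ-≤ (p * (p + R)) (m≤m+n p R) ⟩
      p * (p + R) + (p + R)  ≡⟨ merge p R ⟩
      (p + R) * suc p        ∎

  bernoulli-× : ∀ u r .{{_ : NonZero r}} → u * (suc u * r) ^ r ≤ suc u * (suc u * r ∸ 1) ^ r
  bernoulli-× zero    r          = z≤n
  bernoulli-× (suc u) r@(suc r′) = *-cancelˡ-≤ r (begin
    r * (suc u * D ^ r)              ≡⟨ x∙yz≈z∙yx r (suc u) (D ^ r) ⟩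
    D ^ r * (suc u * r)              ≤⟨ bernoulli ⟩
    D * (D ∸ 1) ^ r                  ≡⟨ xy∙z≈y∙xz (suc (suc u)) r ((D ∸ 1) ^ r) ⟩
    r * (suc (suc u) * (D ∸ 1) ^ r)  ∎)
    where
    open ≤-Reasoning
    D = suc (suc u) * r
    q = r′ + u * r
    bernoulli : D ^ r * suc q ≤ D * (D ∸ 1) ^ r
    bernoulli = subst (λ x → x ^ r * suc q ≤ x * (x ∸ 1) ^ r) (sym (+-suc r q)) (bernoulli⁻ r q)

  2*p^R<[1+p]^R : ∀ p .{{_ : NonZero p}} R → suc p ≤ R → 2 * p ^ R < suc p ^ R
  2*p^R<[1+p]^R p R 1+p≤R = *-cancelˡ-< p (2 * p ^ R) (suc p ^ R) (begin-strict
    p * (2 * p ^ R)  ≡⟨ rearrange p (p ^ R) ⟩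
    p ^ R * (p + p)  <⟨ *-monoʳ-< (p ^ R) {{m^n≢0 p R}} (+-monoʳ-< p 1+p≤R) ⟩
    p ^ R * (p + R)  ≤⟨ bernoulli⁺ p R ⟩
    p * suc p ^ R    ∎)
    where
    open ≤-Reasoning
    rearrange : ∀ p x → p * (2 * x) ≡ x * (p + p)
    rearrange = solve-∀

  [1+p]^R≤2*p^R⇒R<R₀ : ∀ p R₀ R → 2 * p ^ R₀ < suc p ^ R₀ → suc p ^ R ≤ 2 * p ^ R → R < R₀
  [1+p]^R≤2*p^R⇒R<R₀ p R₀ R 2p^R₀<[1+p]^R₀ [1+p]^R≤2p^R with R <? R₀
  ... | yes R<R₀ = R<R₀
  ... | no  R≮R₀ = contradiction [1+p]^R≤2p^R
    (<⇒≱ (subst (λ x → 2 * p ^ x < suc p ^ x) (m+[n∸m]≡n (≮⇒≥ R≮R₀)) (grow (R ∸ R₀))))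
    where
    open ≤-Reasoning
    step : ∀ R → 2 * p ^ R < suc p ^ R → 2 * p ^ suc R < suc p ^ suc R
    step R 2p^R<[1+p]^R = begin-strict
      2 * (p * p ^ R)            ≡⟨ x∙yz≈y∙xz 2 p (p ^ R) ⟩
      p * (2 * p ^ R)            ≤⟨ *-monoʳ-≤ p (<⇒≤ 2p^R<[1+p]^R) ⟩
      p * suc p ^ R              <⟨ m<n+m (p * suc p ^ R) (m^n>0 (suc p) R) ⟩
      suc p ^ R + p * suc p ^ R  ∎
    grow : ∀ j → 2 * p ^ (R₀ + j) < suc p ^ (R₀ + j)
    grow zero    = subst (λ x → 2 * p ^ x < suc p ^ x) (sym (+-identityʳ R₀)) 2p^R₀<[1+p]^R₀
    grow (suc j) = subst (λ x → 2 * p ^ x < suc p ^ x) (sym (+-suc R₀ j)) (step (R₀ + j) (grow j))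

  [1+m]^h≤2*m^h : ∀ {m h} → 2 * h ≤ m → suc m ^ h ≤ 2 * m ^ h
  [1+m]^h≤2*m^h {m} {h} 2h≤m with q , refl ← m≤n⇒∃[o]m+o≡n (≤-trans (m≤m+n h (h + 0)) 2h≤m) =
    *-cancelˡ-≤ (suc m) (begin
      suc m * suc m ^ h        ≡⟨ *-comm (suc m) (suc m ^ h) ⟩
      suc m ^ h * suc m        ≤⟨ *-monoʳ-≤ (suc m ^ h) 1+m≤2[1+q] ⟩
      suc m ^ h * (2 * suc q)  ≡⟨ x∙yz≈y∙xz (suc m ^ h) 2 (suc q) ⟩
      2 * (suc m ^ h * suc q)  ≤⟨ *-monoʳ-≤ 2 (bernoulli⁻ h q) ⟩
      2 * (suc m * m ^ h)      ≡⟨ x∙yz≈y∙xz 2 (suc m) (m ^ h) ⟩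
      suc m * (2 * m ^ h)      ∎)
    where
    open ≤-Reasoning
    2+[q+q]≡2*[1+q] : ∀ q → 2 + (q + q) ≡ 2 * suc q
    2+[q+q]≡2*[1+q] = solve-∀
    1+m≤2[1+q] : suc (h + q) ≤ 2 * suc q
    h≤q : h ≤ q
    h≤q = +-cancelˡ-≤ h h q (subst (_≤ h + q) (cong (h +_) (+-identityʳ h)) 2h≤m)
    1+m≤2[1+q] = begin
      suc (h + q)  ≤⟨ s≤s (+-monoˡ-≤ q h≤q) ⟩
      suc (q + q)  <⟨ n<1+n _ ⟩
      2 + (q + q)  ≡⟨ 2+[q+q]≡2*[1+q] q ⟩
      2 * suc q    ∎

module Weights where

  open import Data.Nat
  open import Data.Nat.Properties
  open import Data.Nat.ListAction using (sum; product)
  open import Data.Nat.Tactic.RingSolver using (solve-∀)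
  open import Algebra.Properties.CommutativeSemigroup *-commutativeSemigroup using (x∙yz≈y∙xz)
  open import Data.List using (List; []; _∷_; map; length)
  open import Data.Product using (∃; _×_; _,_)
  open import Data.Unit using (tt)
  open import Relation.Binary.PropositionalEquality
  open import Relation.Nullary using (yes; no; contradiction)
  open Powers

  mersenne : ℕ → ℕ
  mersenne s = 2 ^ s ∸ 1

  1+mersenne : ∀ s → suc (mersenne s) ≡ 2 ^ s
  1+mersenne s = trans (+-comm 1 (mersenne s)) (m∸n+n≡m (m^n>0 2 s))

  mersenne-suc : ∀ s → mersenne (suc s) ≡ 2 ^ s + mersenne s
  mersenne-suc s = begin
    2 ^ s + (2 ^ s + 0) ∸ 1  ≡⟨ cong (λ x → 2 ^ s + x ∸ 1) (+-identityʳ (2 ^ s)) ⟩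
    2 ^ s + 2 ^ s ∸ 1        ≡⟨ +-∸-assoc (2 ^ s) (m^n>0 2 s) ⟩
    2 ^ s + mersenne s       ∎
    where open ≡-Reasoning

  weight : ℕ → ℕ → ℕ
  weight K s with s ≤? K
  ... | yes _ = 2 ^ (K ∸ s)
  ... | no  _ = 0

  weight-≤ : ∀ {K s} → s ≤ K → weight K s ≡ 2 ^ (K ∸ s)
  weight-≤ {K} {s} s≤K with s ≤? K
  ... | yes _   = refl
  ... | no  s≰K = contradiction s≤K s≰K

  mersenne-weight : ∀ K s → mersenne s * (2 ^ K) ^ weight K s ≤ 2 ^ s * mersenne K ^ weight K s
  mersenne-weight K s with s ≤? K
  ... | no  _   = *-monoˡ-≤ 1 (m∸n≤m (2 ^ s) 1)
  ... | yes s≤K =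
    subst (λ D → mersenne s * D ^ r ≤ 2 ^ s * (D ∸ 1) ^ r) 2^s*r≡2^K
      (subst (λ c → mersenne s * (c * r) ^ r ≤ c * (c * r ∸ 1) ^ r) (1+mersenne s)
        (bernoulli-× (mersenne s) r {{m^n≢0 2 (K ∸ s)}}))
    where
    r = 2 ^ (K ∸ s)
    2^s*r≡2^K : 2 ^ s * r ≡ 2 ^ K
    2^s*r≡2^K = trans (sym (^-distribˡ-+-* 2 s (K ∸ s))) (cong (2 ^_) (m+[n∸m]≡n s≤K))

  weight-linear : ∀ k e s → 2 ^ e * (k + 2) ≤ 2 ^ e * s + weight (suc (e + k)) s
  weight-linear k e s with k + 2 ≤? s
  ... | yes k+2≤s = ≤-trans (*-monoʳ-≤ (2 ^ e) k+2≤s) (m≤m+n (2 ^ e * s) _)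
  ... | no  k+2≰s = begin
    2 ^ e * (k + 2)                    ≡⟨ cong (2 ^ e *_) k+2≡s+[1+d] ⟩
    2 ^ e * (s + suc d)                ≡⟨ *-distribˡ-+ (2 ^ e) s (suc d) ⟩
    2 ^ e * s + 2 ^ e * suc d          ≤⟨ +-monoʳ-≤ (2 ^ e * s) (*-monoʳ-≤ (2 ^ e) (n<2^n d)) ⟩
    2 ^ e * s + 2 ^ e * 2 ^ d          ≡⟨ cong (2 ^ e * s +_) 2^e*2^d≡2^[K∸s] ⟩
    2 ^ e * s + 2 ^ (suc (e + k) ∸ s)  ≡⟨ cong (2 ^ e * s +_) (weight-≤ (≤-trans s≤1+k (s≤s (m≤n+m k e)))) ⟨
    2 ^ e * s + weight (suc (e + k)) s ∎
    where
    open ≤-Reasoning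
    s≤1+k : s ≤ suc k
    s≤1+k = m<1+n⇒m≤n (subst (s <_) (+-comm k 2) (≰⇒> k+2≰s))
    d = suc k ∸ s
    k+2≡s+[1+d] : k + 2 ≡ s + suc d
    k+2≡s+[1+d] = trans (+-comm k 2) (trans (cong suc (sym (m+[n∸m]≡n s≤1+k))) (sym (+-suc s d)))
    2^e*2^d≡2^[K∸s] : 2 ^ e * 2 ^ d ≡ 2 ^ (suc (e + k) ∸ s)
    2^e*2^d≡2^[K∸s] = begin-equality
      2 ^ e * 2 ^ d          ≡⟨ *-comm (2 ^ e) (2 ^ d) ⟩
      2 ^ d * 2 ^ e          ≡⟨ ^-distribˡ-+-* 2 d e ⟨
      2 ^ (d + e)            ≡⟨ cong (2 ^_) (+-∸-comm e s≤1+k) ⟨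
      2 ^ (suc k + e ∸ s)    ≡⟨ cong (λ x → 2 ^ (suc x ∸ s)) (+-comm k e) ⟩
      2 ^ (suc (e + k) ∸ s)  ∎

  budget : ℕ → List ℕ → ℕ
  budget K ss = sum (map (weight K) ss)

  product-mersenne-budget : ∀ K ss →
    product (map mersenne ss) * (2 ^ K) ^ budget K ss ≤ 2 ^ sum ss * mersenne K ^ budget K ss
  product-mersenne-budget K []       = ≤-refl
  product-mersenne-budget K (s ∷ ss) = begin
    mersenne s * W * D ^ (w + B)      ≡⟨ cong (mersenne s * W *_) (^-distribˡ-+-* D w B) ⟩
    mersenne s * W * (D ^ w * D ^ B)  ≡⟨ [m*n]*[o*p]≡[m*o]*[n*p] (mersenne s) W (D ^ w) (D ^ B) ⟩
    mersenne s * D ^ w * (W * D ^ B)  ≤⟨ *-mono-≤ (mersenne-weight K s) (product-mersenne-budget K ss) ⟩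
    2 ^ s * E ^ w * (2 ^ S * E ^ B)   ≡⟨ [m*n]*[o*p]≡[m*o]*[n*p] (2 ^ s) (E ^ w) (2 ^ S) (E ^ B) ⟩
    2 ^ s * 2 ^ S * (E ^ w * E ^ B)   ≡⟨ cong₂ _*_ (^-distribˡ-+-* 2 s S) (^-distribˡ-+-* E w B) ⟨
    2 ^ (s + S) * E ^ (w + B)         ∎
    where
    open ≤-Reasoning
    D = 2 ^ K
    E = mersenne K
    W = product (map mersenne ss)
    S = sum ss
    w = weight K s
    B = budget K ss

  budget-linear : ∀ k e ss → 2 ^ e * ((k + 2) * length ss) ≤ 2 ^ e * sum ss + budget (suc (e + k)) ss
  budget-linear k e []       = ≤-reflexive (trans (cong (2 ^ e *_) (*-zeroʳ (k + 2))) (sym (+-identityʳ (2 ^ e * 0))))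
  budget-linear k e (s ∷ ss) = begin
    2 ^ e * ((k + 2) * suc (length ss))              ≡⟨ distribute (2 ^ e) (k + 2) (length ss) ⟩
    2 ^ e * (k + 2) + 2 ^ e * ((k + 2) * length ss)  ≤⟨ +-mono-≤ (weight-linear k e s) (budget-linear k e ss) ⟩
    2 ^ e * s + w + (2 ^ e * sum ss + B)             ≡⟨ regroup (2 ^ e) s w (sum ss) B ⟩
    2 ^ e * (s + sum ss) + (w + B)                   ∎
    where
    open ≤-Reasoning
    w = weight (suc (e + k)) s
    B = budget (suc (e + k)) ss
    distribute : ∀ p a t → p * (a * suc t) ≡ p * a + p * (a * t)
    distribute = solve-∀
    regroup : ∀ p s w S B → p * s + w + (p * S + B) ≡ p * (s + S) + (w + B)
    regroup = solve-∀

  -- The consequences, at every level K = e + k + 1, of t pairwise disjoint sets inside [n] with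
  -- ∏ (1 − 2^−sᵢ) ≥ 1/2; R is their total weight.
  Admissible : ℕ → ℕ → Set
  Admissible n t = ∀ k e → ∃ λ R →
    (2 ^ suc (e + k)) ^ R ≤ 2 * mersenne (suc (e + k)) ^ R × 2 ^ e * ((k + 2) * t) ≤ 2 ^ e * n + R

  admissible : ∀ {n} ss → sum ss ≤ n → 2 ^ sum ss ≤ 2 * product (map mersenne ss) → Admissible n (length ss)
  admissible {n} ss S≤n 2^S≤2W k e = budget K ss , halving , linear
    where
    K = suc (e + k)
    B = budget K ss
    halving : (2 ^ K) ^ B ≤ 2 * mersenne K ^ B
    halving = *-cancelˡ-≤ (2 ^ sum ss) {{m^n≢0 2 (sum ss)}} (begin
      2 ^ sum ss * (2 ^ K) ^ B                       ≤⟨ *-monoˡ-≤ ((2 ^ K) ^ B) 2^S≤2W ⟩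
      2 * product (map mersenne ss) * (2 ^ K) ^ B    ≡⟨ *-assoc 2 (product (map mersenne ss)) ((2 ^ K) ^ B) ⟩
      2 * (product (map mersenne ss) * (2 ^ K) ^ B)  ≤⟨ *-monoʳ-≤ 2 (product-mersenne-budget K ss) ⟩
      2 * (2 ^ sum ss * mersenne K ^ B)              ≡⟨ x∙yz≈y∙xz 2 (2 ^ sum ss) (mersenne K ^ B) ⟩
      2 ^ sum ss * (2 * mersenne K ^ B)              ∎)
      where open ≤-Reasoning
    linear : 2 ^ e * ((k + 2) * length ss) ≤ 2 ^ e * n + B
    linear = ≤-trans (budget-linear k e ss) (+-monoˡ-≤ B (*-monoʳ-≤ (2 ^ e) S≤n))

  [2^K]^R≤2*mersenne[K]^R⇒R<2^K : ∀ K R → (2 ^ suc K) ^ R ≤ 2 * mersenne (suc K) ^ R → R < 2 ^ suc K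
  [2^K]^R≤2*mersenne[K]^R⇒R<2^K K R halving =
    subst (R <_) (1+mersenne (suc K))
      ([1+p]^R≤2*p^R⇒R<R₀ p (suc p) R (2*p^R<[1+p]^R p {{p≢0}} (suc p) ≤-refl)
        (subst (λ x → x ^ R ≤ 2 * p ^ R) (sym (1+mersenne (suc K))) halving))
    where
    p = mersenne (suc K)
    p≢0 : NonZero p
    p≢0 = >-nonZero (+-cancelˡ-≤ 1 1 p (subst (2 ≤_) (sym (1+mersenne (suc K))) (*-monoʳ-≤ 2 (m^n>0 2 K))))

  [2^14]^R≤2*mersenne[14]^R⇒R≤11356 : ∀ R → (2 ^ 14) ^ R ≤ 2 * mersenne 14 ^ R → R ≤ 11356
  [2^14]^R≤2*mersenne[14]^R⇒R≤11356 R halving =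
    m<1+n⇒m≤n ([1+p]^R≤2*p^R⇒R<R₀ (mersenne 14) 11357 R (<ᵇ⇒< _ _ tt) halving)

  admissible⇒L*t≤n : ∀ {n t L} → 2 ^ L ≤ t → Admissible n t → L * t ≤ n
  admissible⇒L*t≤n {n} {t} {L} 2ᴸ≤t adm with R , halving , linear ← adm L 0 =
    <⇒≤ (+-cancelʳ-≤ (2 * t) (suc (L * t)) n (begin
      suc (L * t) + 2 * t  ≡⟨ cong suc (*-distribʳ-+ t L 2) ⟨
      suc ((L + 2) * t)    ≤⟨ s≤s (subst₂ _≤_ (*-identityˡ _) (cong (_+ R) (*-identityˡ n)) linear) ⟩
      suc (n + R)          ≡⟨ +-suc n R ⟨
      n + suc R            ≤⟨ +-monoʳ-≤ n (<-≤-trans R<2ᴸ⁺¹ (*-monoʳ-≤ 2 2ᴸ≤t)) ⟩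
      n + 2 * t            ∎))
    where
    open ≤-Reasoning
    R<2ᴸ⁺¹ = [2^K]^R≤2*mersenne[K]^R⇒R<2^K L R halving

module UpClosure where

  open import Data.Nat using (ℕ; zero; suc; _+_; _*_; _^_; _≤_; z≤n; s≤s)
  open import Data.Nat.Properties
  open import Data.Nat.ListAction using (sum; product)
  open import Data.Nat.ListAction.Properties using (sum-↭; product-↭)
  open import Data.Nat.Tactic.RingSolver using (solve-∀)
  open import Algebra.Properties.CommutativeSemigroup *-commutativeSemigroup using (xy∙z≈y∙xz)
  open import Data.Fin using (zero)
  open import Data.Fin.Subset using (Subset; _∩_; _⊆_; Empty; ∣_∣; inside; outside)
  open import Data.Fin.Subset.Properties using (_⊆?_; drop-∷-Empty; out⊆-⇔; in⊆in-⇔; x∈p∩q⁺; x∈p∩q⁻)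
  open import Data.List using (List; []; _∷_; [_]; _++_; map; length; filter)
  open import Data.List.Properties using (length-++; length-++-sucʳ; length-map; filter-++; filter-≐; map-∘)
  open import Data.List.Membership.Propositional using (_∈_; find)
  open import Data.List.Membership.Propositional.Properties
    using (∈-++⁺ˡ; ∈-++⁺ʳ; ∈-++⁻; ∈-map⁻; ∈-filter⁻; ∈-∃++)
  open import Data.List.Relation.Unary.All as All using (All; []; _∷_)
  import Data.List.Relation.Unary.All.Properties as All
  open import Data.List.Relation.Unary.AllPairs as AllPairs using (AllPairs; []; _∷_)
  import Data.List.Relation.Unary.AllPairs.Properties as AllPairs
  open import Data.List.Relation.Unary.Any as Any using (Any; here; there; any?)
  import Data.List.Relation.Unary.Any.Properties as Any
  open import Data.List.Relation.Unary.Unique.Propositional using (Unique)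
  import Data.List.Relation.Unary.Unique.Propositional.Properties as Unique
  open import Data.List.Relation.Binary.Permutation.Propositional
    using (_↭_; ↭-refl; ↭-prep; ↭-swap; ↭-trans; ↭-sym; ↭-reflexive; ↭⇒↭ₛ)
  import Data.List.Relation.Binary.Permutation.Propositional.Properties as ↭
  import Data.List.Relation.Binary.Permutation.Setoid.Properties as ↭ₛ
  open import Data.Product using (∃; ∃₂; _×_; _,_; proj₂; swap)
  open import Data.Sum using (_⊎_; inj₁; inj₂)
  open import Data.Vec using ([]; _∷_; tail)
  import Data.Vec.Base as Vec
  open import Data.Vec.Properties using (∷-injectiveʳ)
  open import Function using (_∘_; id; _⇔_; mk⇔; Equivalence)
  open import Level using (Level; 0ℓ)
  open import Relation.Binary.PropositionalEquality
    using (_≡_; refl; sym; trans; cong; cong₂; subst; resp₂; setoid; module ≡-Reasoning)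
  open import Relation.Nullary using (¬_; yes; no; contradiction)
  open import Relation.Unary using (Pred; Decidable)
  open import Relation.Unary.Properties using (∁?)
  open Equivalence using (to; from)
  open Weights using (mersenne; mersenne-suc)

  private variable
    n : ℕ
    a p : Level
    A : Set a

  Disjoint : Subset n → Subset n → Set
  Disjoint A B = Empty (A ∩ B)

  PairwiseDisjoint : List (Subset n) → Set
  PairwiseDisjoint = AllPairs Disjoint

  subsets : ∀ n → List (Subset n)
  subsets zero    = [ [] ]
  subsets (suc n) = map (outside ∷_) (subsets n) ++ map (inside ∷_) (subsets n)

  subsets-unique : ∀ n → Unique (subsets n)
  subsets-unique zero    = [] ∷ []
  subsets-unique (suc n) =
    Unique.++⁺ (Unique.map⁺ ∷-injectiveʳ (subsets-unique n)) (Unique.map⁺ ∷-injectiveʳ (subsets-unique n))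
      heads-differ
    where
    heads-differ : ∀ {B} → ¬ (B ∈ map (outside ∷_) (subsets n) × B ∈ map (inside ∷_) (subsets n))
    heads-differ (B∈₀ , B∈₁) with ∈-map⁻ (outside ∷_) B∈₀ | ∈-map⁻ (inside ∷_) B∈₁
    ... | _ , _ , refl | _ , _ , ()

  length-subsets : ∀ n → length (subsets n) ≡ 2 ^ n
  length-subsets zero    = refl
  length-subsets (suc n) = begin
    length (map (outside ∷_) (subsets n) ++ map (inside ∷_) (subsets n))
      ≡⟨ length-++ (map (outside ∷_) (subsets n)) ⟩
    length (map (outside ∷_) (subsets n)) + length (map (inside ∷_) (subsets n))
      ≡⟨ cong₂ _+_ (length-map (outside ∷_) (subsets n)) (length-map (inside ∷_) (subsets n)) ⟩
    length (subsets n) + length (subsets n)  ≡⟨ cong (λ m → m + m) (length-subsets n) ⟩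
    2 ^ n + 2 ^ n                            ≡⟨ cong (2 ^ n +_) (+-identityʳ (2 ^ n)) ⟨
    2 ^ suc n                                ∎
    where open ≡-Reasoning

  module _ {P : Pred A p} (P? : Decidable P) where

    length-filter+length-filter-∁ : ∀ xs → length (filter P? xs) + length (filter (∁? P?) xs) ≡ length xs
    length-filter+length-filter-∁ []       = refl
    length-filter+length-filter-∁ (x ∷ xs) with P? x
    ... | yes _ = cong suc (length-filter+length-filter-∁ xs)
    ... | no  _ = trans (+-suc _ _) (cong suc (length-filter+length-filter-∁ xs))

    length-filter-map : ∀ {b} {B : Set b} (f : B → A) xs → length (filter P? (map f xs)) ≡ length (filter (P? ∘ f) xs)
    length-filter-map f []       = refl
    length-filter-map f (x ∷ xs) with P? (f x)
    ... | yes _ = cong suc (length-filter-map f xs)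
    ... | no  _ = length-filter-map f xs

  Unique-⊆⇒length≤ : ∀ {xs ys : List A} → Unique xs → (∀ {x} → x ∈ xs → x ∈ ys) → length xs ≤ length ys
  Unique-⊆⇒length≤ {xs = []}     _            _     = z≤n
  Unique-⊆⇒length≤ {xs = x ∷ xs} (x∉xs ∷ !xs) xs⊆ys with ys₁ , ys₂ , refl ← ∈-∃++ (xs⊆ys (here refl)) =
    subst (suc (length xs) ≤_) (sym (length-++-sucʳ ys₁ x ys₂)) (s≤s (Unique-⊆⇒length≤ !xs xs⊆ys₁++ys₂))
    where
    xs⊆ys₁++ys₂ : ∀ {z} → z ∈ xs → z ∈ ys₁ ++ ys₂
    xs⊆ys₁++ys₂ {z} z∈xs with ∈-++⁻ ys₁ (xs⊆ys (there z∈xs))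
    ... | inj₁ z∈ys₁         = ∈-++⁺ˡ z∈ys₁
    ... | inj₂ (here refl)   = contradiction refl (All.lookup x∉xs z∈xs)
    ... | inj₂ (there z∈ys₂) = ∈-++⁺ʳ ys₁ z∈ys₂

  length-filter-subsets : ∀ {P : Pred (Subset (suc n)) p} (P? : Decidable P) →
    length (filter P? (subsets (suc n))) ≡
    length (filter (P? ∘ (outside ∷_)) (subsets n)) + length (filter (P? ∘ (inside ∷_)) (subsets n))
  length-filter-subsets {n} P? = begin
    length (filter P? (map (outside ∷_) (subsets n) ++ map (inside ∷_) (subsets n)))
      ≡⟨ cong length (filter-++ P? (map (outside ∷_) (subsets n)) _) ⟩
    length (filter P? (map (outside ∷_) (subsets n)) ++ filter P? (map (inside ∷_) (subsets n)))
      ≡⟨ length-++ (filter P? (map (outside ∷_) (subsets n))) ⟩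
    length (filter P? (map (outside ∷_) (subsets n))) + length (filter P? (map (inside ∷_) (subsets n)))
      ≡⟨ cong₂ _+_ (length-filter-map P? (outside ∷_) (subsets n)) (length-filter-map P? (inside ∷_) (subsets n)) ⟩
    length (filter (P? ∘ (outside ∷_)) (subsets n)) + length (filter (P? ∘ (inside ∷_)) (subsets n)) ∎
    where open ≡-Reasoning

  Disjoint-sym : {A B : Subset n} → Disjoint A B → Disjoint B A
  Disjoint-sym {A = A} {B} A∩B≡∅ (x , x∈B∩A) = A∩B≡∅ (x , x∈p∩q⁺ (swap (x∈p∩q⁻ B A x∈B∩A)))

  PairwiseDisjoint-resp-↭ : {xs ys : List (Subset n)} → xs ↭ ys → PairwiseDisjoint xs → PairwiseDisjoint ys
  PairwiseDisjoint-resp-↭ xs↭ys = ↭ₛ.AllPairs-resp-↭ (setoid _) Disjoint-sym (resp₂ Disjoint) (↭⇒↭ₛ xs↭ys)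

  PairwiseDisjoint-outside : {ys : List (Subset n)} → PairwiseDisjoint (map (outside ∷_) ys) → PairwiseDisjoint ys
  PairwiseDisjoint-outside = AllPairs.map drop-∷-Empty ∘ AllPairs.map⁻

  PairwiseDisjoint-inside : ∀ {A} {ys : List (Subset n)} →
    PairwiseDisjoint ((inside ∷ A) ∷ map (outside ∷_) ys) → PairwiseDisjoint (A ∷ ys)
  PairwiseDisjoint-inside (A# ∷ #ys) = All.map drop-∷-Empty (All.map⁻ A#) ∷ PairwiseDisjoint-outside #ys

  at-most-one-inside : (xs : List (Subset (suc n))) → PairwiseDisjoint xs →
    (∃ λ ys → xs ↭ map (outside ∷_) ys) ⊎ (∃₂ λ A ys → xs ↭ (inside ∷ A) ∷ map (outside ∷_) ys)
  at-most-one-inside []                   _          = inj₁ ([] , ↭-refl)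
  at-most-one-inside ((outside ∷ A) ∷ xs) (_ ∷ #xs) with at-most-one-inside xs #xs
  ... | inj₁ (ys , xs↭)      = inj₁ (A ∷ ys , ↭-prep _ xs↭)
  ... | inj₂ (A′ , ys , xs↭) = inj₂ (A′ , A ∷ ys , ↭-trans (↭-prep _ xs↭) (↭-swap _ _ ↭-refl))
  at-most-one-inside ((inside ∷ A) ∷ xs)  (A# ∷ _)  =
    inj₂ (A , map tail xs , ↭-prep _ (↭-reflexive (outside-headed xs A#)))
    where
    outside-headed : ∀ xs → All (Disjoint (inside ∷ A)) xs → xs ≡ map (outside ∷_) (map tail xs)
    outside-headed []                   []         = refl
    outside-headed ((outside ∷ B) ∷ xs) (_ ∷ A#)   = cong ((outside ∷ B) ∷_) (outside-headed xs A#)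
    outside-headed ((inside ∷ B) ∷ xs)  (A∩B≡∅ ∷ _) = contradiction (zero , Vec.here) A∩B≡∅

  Above : List (Subset n) → Pred (Subset n) 0ℓ
  Above xs B = Any (_⊆ B) xs

  above? : (xs : List (Subset n)) → Decidable (Above xs)
  above? xs B = any? (_⊆? B) xs

  ↑ : List (Subset n) → List (Subset n)
  ↑ xs = filter (above? xs) (subsets _)

  ↑ᶜ : List (Subset n) → List (Subset n)
  ↑ᶜ xs = filter (∁? (above? xs)) (subsets _)

  length-↑+length-↑ᶜ : (xs : List (Subset n)) → length (↑ xs) + length (↑ᶜ xs) ≡ 2 ^ n
  length-↑+length-↑ᶜ {n} xs = trans (length-filter+length-filter-∁ (above? xs) (subsets n)) (length-subsets n)

  length-↑ᶜ-cong : ∀ {m} {xs : List (Subset n)} {ys : List (Subset m)} (f : Subset m → Subset n) →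
    (∀ {B} → Above xs (f B) ⇔ Above ys B) → length (filter (∁? (above? xs) ∘ f) (subsets m)) ≡ length (↑ᶜ ys)
  length-↑ᶜ-cong {m = m} {xs = xs} {ys = ys} f xs≐ys = cong length (filter-≐ (∁? (above? xs) ∘ f) (∁? (above? ys))
    ((λ ¬a a → ¬a (from xs≐ys a)) , (λ ¬a a → ¬a (to xs≐ys a))) (subsets m))

  length-↑ᶜ-↭ : {xs ys : List (Subset n)} → xs ↭ ys → length (↑ᶜ xs) ≡ length (↑ᶜ ys)
  length-↑ᶜ-↭ xs↭ys = length-↑ᶜ-cong id (mk⇔ (↭.Any-resp-↭ xs↭ys) (↭.Any-resp-↭ (↭-sym xs↭ys)))

  Above-outside : ∀ {s B} (ys : List (Subset n)) → Above (map (outside ∷_) ys) (s ∷ B) ⇔ Above ys B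
  Above-outside ys = mk⇔ (Any.map (from out⊆-⇔) ∘ Any.map⁻) (Any.map⁺ ∘ Any.map (to out⊆-⇔))

  Above-inside : ∀ {A B} (ys : List (Subset n)) →
    Above ((inside ∷ A) ∷ map (outside ∷_) ys) (inside ∷ B) ⇔ Above (A ∷ ys) B
  Above-inside ys = mk⇔
    (λ { (here A⊆B) → here (from in⊆in-⇔ A⊆B) ; (there a) → there (to (Above-outside ys) a) })
    (λ { (here A⊆B) → here (to in⊆in-⇔ A⊆B)   ; (there a) → there (from (Above-outside ys) a) })

  Above-inside-outside : ∀ {A B} (ys : List (Subset n)) →
    Above ((inside ∷ A) ∷ map (outside ∷_) ys) (outside ∷ B) ⇔ Above ys B
  Above-inside-outside ys = mk⇔
    (λ { (here A⊆B) → contradiction (A⊆B Vec.here) λ () ; (there a) → to (Above-outside ys) a })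
    (there ∘ from (Above-outside ys))

  length-↑ᶜ-outside : (ys : List (Subset n)) →
    length (↑ᶜ (map (outside ∷_) ys)) ≡ length (↑ᶜ ys) + length (↑ᶜ ys)
  length-↑ᶜ-outside ys = trans (length-filter-subsets (∁? (above? (map (outside ∷_) ys))))
    (cong₂ _+_ (length-↑ᶜ-cong (outside ∷_) (Above-outside ys)) (length-↑ᶜ-cong (inside ∷_) (Above-outside ys)))

  length-↑ᶜ-inside : ∀ A (ys : List (Subset n)) →
    length (↑ᶜ ((inside ∷ A) ∷ map (outside ∷_) ys)) ≡ length (↑ᶜ ys) + length (↑ᶜ (A ∷ ys))
  length-↑ᶜ-inside A ys = trans (length-filter-subsets (∁? (above? ((inside ∷ A) ∷ map (outside ∷_) ys))))
    (cong₂ _+_ (length-↑ᶜ-cong (outside ∷_) (Above-inside-outside ys)) (length-↑ᶜ-cong (inside ∷_) (Above-inside ys)))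

  sizes : List (Subset n) → List ℕ
  sizes = map ∣_∣

  sizes-outside : (ys : List (Subset n)) → sizes (map (outside ∷_) ys) ≡ sizes ys
  sizes-outside ys = sym (map-∘ ys)

  AvoidFormula : List (Subset n) → Set
  AvoidFormula {n} xs = length (↑ᶜ xs) * 2 ^ sum (sizes xs) ≡ 2 ^ n * product (map mersenne (sizes xs))

  AvoidFormula-resp-↭ : {xs ys : List (Subset n)} → xs ↭ ys → AvoidFormula ys → AvoidFormula xs
  AvoidFormula-resp-↭ {n} {xs} {ys} xs↭ys formula = begin
    length (↑ᶜ xs) * 2 ^ sum (sizes xs)
      ≡⟨ cong₂ (λ c S → c * 2 ^ S) (length-↑ᶜ-↭ xs↭ys) (sum-↭ sizes↭) ⟩
    length (↑ᶜ ys) * 2 ^ sum (sizes ys)        ≡⟨ formula ⟩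
    2 ^ n * product (map mersenne (sizes ys))  ≡⟨ cong (2 ^ n *_) (product-↭ (↭.map⁺ mersenne sizes↭)) ⟨
    2 ^ n * product (map mersenne (sizes xs))  ∎
    where
    open ≡-Reasoning
    sizes↭ = ↭.map⁺ ∣_∣ xs↭ys

  AvoidFormula-outside : (ys : List (Subset n)) → AvoidFormula ys → AvoidFormula (map (outside ∷_) ys)
  AvoidFormula-outside {n} ys formula = begin
    length (↑ᶜ (map (outside ∷_) ys)) * 2 ^ sum (sizes (map (outside ∷_) ys))
      ≡⟨ cong₂ (λ c ss → c * 2 ^ sum ss) (length-↑ᶜ-outside ys) (sizes-outside ys) ⟩
    (X + X) * 2 ^ S      ≡⟨ double X (2 ^ S) ⟩
    2 * (X * 2 ^ S)      ≡⟨ cong (2 *_) formula ⟩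
    2 * (2 ^ n * W)      ≡⟨ *-assoc 2 (2 ^ n) W ⟨
    2 ^ suc n * W        ≡⟨ cong (λ ss → 2 ^ suc n * product (map mersenne ss)) (sizes-outside ys) ⟨
    2 ^ suc n * product (map mersenne (sizes (map (outside ∷_) ys))) ∎
    where
    open ≡-Reasoning
    X = length (↑ᶜ ys)
    S = sum (sizes ys)
    W = product (map mersenne (sizes ys))
    double : ∀ x p → (x + x) * p ≡ 2 * (x * p)
    double = solve-∀

  AvoidFormula-inside : ∀ A (ys : List (Subset n)) → AvoidFormula ys → AvoidFormula (A ∷ ys) →
    AvoidFormula ((inside ∷ A) ∷ map (outside ∷_) ys)
  AvoidFormula-inside {n} A ys formulaₓ formulaᵧ = begin
    length (↑ᶜ ((inside ∷ A) ∷ map (outside ∷_) ys)) * 2 ^ (suc k + sum (sizes (map (outside ∷_) ys)))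
      ≡⟨ cong₂ (λ c ss → c * 2 ^ (suc k + sum ss)) (length-↑ᶜ-inside A ys) (sizes-outside ys) ⟩
    (X + Y) * 2 ^ (suc k + S)                      ≡⟨ cong ((X + Y) *_) (^-distribˡ-+-* 2 (suc k) S) ⟩
    (X + Y) * (2 * 2 ^ k * 2 ^ S)                  ≡⟨ expand X Y (2 ^ k) (2 ^ S) ⟩
    2 * (2 ^ k * (X * 2 ^ S) + Y * (2 ^ k * 2 ^ S))
      ≡⟨ cong₂ (λ u v → 2 * (2 ^ k * u + Y * v)) formulaₓ (sym (^-distribˡ-+-* 2 k S)) ⟩
    2 * (2 ^ k * (N * W) + Y * 2 ^ (k + S))         ≡⟨ cong (λ v → 2 * (2 ^ k * (N * W) + v)) formulaᵧ ⟩
    2 * (2 ^ k * (N * W) + N * (mersenne k * W))    ≡⟨ collect (2 ^ k) N W (mersenne k) ⟩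
    2 * N * ((2 ^ k + mersenne k) * W)              ≡⟨ cong (λ c → 2 * N * (c * W)) (mersenne-suc k) ⟨
    2 * N * (mersenne (suc k) * W)
      ≡⟨ cong (λ ss → 2 * N * (mersenne (suc k) * product (map mersenne ss))) (sizes-outside ys) ⟨
    2 ^ suc n * product (map mersenne (sizes ((inside ∷ A) ∷ map (outside ∷_) ys))) ∎
    where
    open ≡-Reasoning
    k = ∣ A ∣
    X = length (↑ᶜ ys)
    Y = length (↑ᶜ (A ∷ ys))
    S = sum (sizes ys)
    W = product (map mersenne (sizes ys))
    N = 2 ^ n
    expand : ∀ x y p q → (x + y) * (2 * p * q) ≡ 2 * (p * (x * q) + y * (p * q))
    expand = solve-∀
    collect : ∀ p N W w → 2 * (p * (N * W) + N * (w * W)) ≡ 2 * N * ((p + w) * W)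
    collect = solve-∀

  avoidFormula : (xs : List (Subset n)) → PairwiseDisjoint xs → AvoidFormula xs
  avoidFormula {zero}  []       _   = refl
  avoidFormula {zero}  ([] ∷ _) _   = refl
  avoidFormula {suc n} xs       #xs with at-most-one-inside xs #xs
  ... | inj₁ (ys , xs↭) = AvoidFormula-resp-↭ xs↭
    (AvoidFormula-outside ys (avoidFormula ys (PairwiseDisjoint-outside (PairwiseDisjoint-resp-↭ xs↭ #xs))))
  ... | inj₂ (A , ys , xs↭) with #A∷ys@(_ ∷ #ys) ← PairwiseDisjoint-inside (PairwiseDisjoint-resp-↭ xs↭ #xs) =
    AvoidFormula-resp-↭ xs↭ (AvoidFormula-inside A ys (avoidFormula ys #ys) (avoidFormula (A ∷ ys) #A∷ys))

  sum-sizes≤n : (xs : List (Subset n)) → PairwiseDisjoint xs → sum (sizes xs) ≤ n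
  sum-sizes≤n {zero}  []        _          = z≤n
  sum-sizes≤n {zero}  ([] ∷ xs) (_ ∷ #xs)  = sum-sizes≤n xs #xs
  sum-sizes≤n {suc n} xs        #xs with at-most-one-inside xs #xs
  ... | inj₁ (ys , xs↭) rewrite sum-↭ (↭.map⁺ ∣_∣ xs↭) | sizes-outside ys =
    m≤n⇒m≤1+n (sum-sizes≤n ys (PairwiseDisjoint-outside (PairwiseDisjoint-resp-↭ xs↭ #xs)))
  ... | inj₂ (A , ys , xs↭) rewrite sum-↭ (↭.map⁺ ∣_∣ xs↭) | sizes-outside ys =
    s≤s (sum-sizes≤n (A ∷ ys) (PairwiseDisjoint-inside (PairwiseDisjoint-resp-↭ xs↭ #xs)))

  mersenne-product-bound : ∀ {m} (𝒰 : Family (suc m)) → IsUpSet 𝒰 → card 𝒰 ≤ 2 ^ m →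
    (xs : List (Subset (suc m))) → PairwiseDisjoint xs → (∀ {A} → A ∈ xs → A ∈ members 𝒰) →
    2 ^ sum (sizes xs) ≤ 2 * product (map mersenne (sizes xs))
  mersenne-product-bound {m} 𝒰 up-set card≤2ᵐ xs #xs xs⊆𝒰 = *-cancelˡ-≤ (2 ^ m) {{m^n≢0 2 m}} (begin
    2 ^ m * 2 ^ S               ≤⟨ *-monoˡ-≤ (2 ^ S) 2ᵐ≤#↑ᶜ ⟩
    length (↑ᶜ xs) * 2 ^ S      ≡⟨ avoidFormula xs #xs ⟩
    2 * 2 ^ m * W               ≡⟨ xy∙z≈y∙xz 2 (2 ^ m) W ⟩
    2 ^ m * (2 * W)             ∎)
    where
    open ≤-Reasoning
    S = sum (sizes xs)
    W = product (map mersenne (sizes xs))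
    ↑⊆𝒰 : ∀ {B} → B ∈ ↑ xs → B ∈ members 𝒰
    ↑⊆𝒰 B∈↑ with A , A∈xs , A⊆B ← find (proj₂ (∈-filter⁻ (above? xs) {xs = subsets (suc m)} B∈↑)) =
      up-set A _ (xs⊆𝒰 A∈xs) A⊆B
    #↑≤2ᵐ : length (↑ xs) ≤ 2 ^ m
    #↑≤2ᵐ = ≤-trans (Unique-⊆⇒length≤ (Unique.filter⁺ (above? xs) (subsets-unique (suc m))) ↑⊆𝒰) card≤2ᵐ
    2ᵐ≤#↑ᶜ : 2 ^ m ≤ length (↑ᶜ xs)
    2ᵐ≤#↑ᶜ = +-cancelˡ-≤ (2 ^ m) (2 ^ m) (length (↑ᶜ xs)) (begin
      2 ^ m + 2 ^ m                        ≡⟨ cong (2 ^ m +_) (+-identityʳ (2 ^ m)) ⟨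
      2 ^ suc m                            ≡⟨ length-↑+length-↑ᶜ xs ⟨
      length (↑ xs) + length (↑ᶜ xs)       ≤⟨ +-monoˡ-≤ (length (↑ᶜ xs)) #↑≤2ᵐ ⟩
      2 ^ m + length (↑ᶜ xs)               ∎)

module LogBound where

  open import Data.Nat
  open import Data.Nat.Properties
  open import Data.Nat.Tactic.RingSolver using (solve-∀)
  open import Algebra.Properties.CommutativeSemigroup *-commutativeSemigroup using (xy∙z≈y∙xz)
  open import Data.Bool using (true)
  open import Data.Product using (∃; _×_; _,_)
  open import Data.Sum using (_⊎_; inj₂; [_,_]′)
  open import Data.Unit using (tt)
  open import Relation.Binary.PropositionalEquality
  open import Relation.Nullary using (Dec; yes; no; contradiction)
  open import Relation.Nullary.Decidable using (does; proof; _×-dec_; _⊎-dec_)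
  open import Relation.Nullary.Reflects using (Reflects; invert)
  open Powers
  open Weights

  -- t · log₂ m < (a / b) · m
  LogBelow : ℕ → ℕ → ℕ → ℕ → Set
  LogBelow a b t m = m ^ (t * b) < 2 ^ (a * m)

  LogBelow-suc : ∀ {a b t m} → b ≤ a → 2 * t ≤ m → LogBelow a b t m → LogBelow a b t (suc m)
  LogBelow-suc {a} {b} {t} {m} b≤a 2t≤m mᵗᵇ<2ᵃᵐ = begin-strict
    suc m ^ (t * b)       ≡⟨ ^-*-assoc (suc m) t b ⟨
    (suc m ^ t) ^ b       ≤⟨ ^-monoˡ-≤ b ([1+m]^h≤2*m^h {m} {t} 2t≤m) ⟩
    (2 * m ^ t) ^ b       ≡⟨ ^-distribʳ-* 2 (m ^ t) b ⟩
    2 ^ b * (m ^ t) ^ b   ≡⟨ cong (2 ^ b *_) (^-*-assoc m t b) ⟩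
    2 ^ b * m ^ (t * b)   <⟨ *-monoʳ-< (2 ^ b) {{m^n≢0 2 b}} mᵗᵇ<2ᵃᵐ ⟩
    2 ^ b * 2 ^ (a * m)   ≤⟨ *-monoˡ-≤ (2 ^ (a * m)) (^-monoʳ-≤ 2 b≤a) ⟩
    2 ^ a * 2 ^ (a * m)   ≡⟨ ^-distribˡ-+-* 2 a (a * m) ⟨
    2 ^ (a + a * m)       ≡⟨ cong (2 ^_) (*-suc a m) ⟨
    2 ^ (a * suc m)       ∎
    where open ≤-Reasoning

  LogBelow-mono : ∀ {a b t m n} → b ≤ a → 2 * t ≤ m → m ≤ n → LogBelow a b t m → LogBelow a b t n
  LogBelow-mono {a} {b} {t} {m} b≤a 2t≤m m≤n below = go (≤⇒≤′ m≤n)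
    where
    go : ∀ {n} → m ≤′ n → LogBelow a b t n
    go ≤′-refl          = below
    go (≤′-step m≤′n) = LogBelow-suc {a} {b} {t} b≤a (≤-trans 2t≤m (≤′⇒≤ m≤′n)) (go m≤′n)

  LogBelow-certificate : ∀ {a b t m} D E .{{_ : NonZero D}} → m ^ D ≤ 2 ^ E → b * t * E < a * m * D → LogBelow a b t m
  LogBelow-certificate {a} {b} {t} {m} D E mᴰ≤2ᴱ btE<amD = ^-cancelˡ-< D (begin-strict
    (m ^ (t * b)) ^ D    ≡⟨ ^-*-assoc m (t * b) D ⟩
    m ^ (t * b * D)      ≡⟨ cong (m ^_) (*-comm (t * b) D) ⟩
    m ^ (D * (t * b))    ≡⟨ ^-*-assoc m D (t * b) ⟨
    (m ^ D) ^ (t * b)    ≤⟨ ^-monoˡ-≤ (t * b) mᴰ≤2ᴱ ⟩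
    (2 ^ E) ^ (t * b)    ≡⟨ ^-*-assoc 2 E (t * b) ⟩
    2 ^ (E * (t * b))    <⟨ ^-monoʳ-< 2 (s≤s (s≤s z≤n)) (subst (_< a * m * D) (swap b t E) btE<amD) ⟩
    2 ^ (a * m * D)      ≡⟨ ^-*-assoc 2 (a * m) D ⟨
    (2 ^ (a * m)) ^ D    ∎)
    where
    open ≤-Reasoning
    swap : ∀ b t E → b * t * E ≡ E * (t * b)
    swap = solve-∀

  L^b*2^b≤2^[c*L] : ∀ b c L₀ .{{_ : NonZero L₀}} →
                    L₀ ^ b * 2 ^ b ≤ 2 ^ (c * L₀) → suc L₀ ^ b ≤ 2 ^ c * L₀ ^ b →
                    ∀ {L} → L₀ ≤ L → L ^ b * 2 ^ b ≤ 2 ^ (c * L)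
  L^b*2^b≤2^[c*L] b c L₀ base ratio L₀≤L = go (≤⇒≤′ L₀≤L)
    where
    open ≤-Reasoning
    ratio-at : ∀ {L} → L₀ ≤ L → suc L ^ b ≤ 2 ^ c * L ^ b
    ratio-at {L} L₀≤L = *-cancelˡ-≤ (L₀ ^ b) {{m^n≢0 L₀ b}} (begin
      L₀ ^ b * suc L ^ b        ≡⟨ ^-distribʳ-* L₀ (suc L) b ⟨
      (L₀ * suc L) ^ b          ≤⟨ ^-monoˡ-≤ b L₀[1+L]≤[1+L₀]L ⟩
      (suc L₀ * L) ^ b          ≡⟨ ^-distribʳ-* (suc L₀) L b ⟩
      suc L₀ ^ b * L ^ b        ≤⟨ *-monoˡ-≤ (L ^ b) ratio ⟩
      2 ^ c * L₀ ^ b * L ^ b    ≡⟨ xy∙z≈y∙xz (2 ^ c) (L₀ ^ b) (L ^ b) ⟩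
      L₀ ^ b * (2 ^ c * L ^ b)  ∎)
      where
      L₀[1+L]≤[1+L₀]L : L₀ * suc L ≤ suc L₀ * L
      L₀[1+L]≤[1+L₀]L = begin
        L₀ * suc L   ≡⟨ *-suc L₀ L ⟩
        L₀ + L₀ * L  ≤⟨ +-monoˡ-≤ (L₀ * L) L₀≤L ⟩
        suc L₀ * L   ∎
    go : ∀ {L} → L₀ ≤′ L → L ^ b * 2 ^ b ≤ 2 ^ (c * L)
    go ≤′-refl               = base
    go (≤′-step {L} L₀≤′L) = begin
      suc L ^ b * 2 ^ b        ≤⟨ *-monoˡ-≤ (2 ^ b) (ratio-at (≤′⇒≤ L₀≤′L)) ⟩
      2 ^ c * L ^ b * 2 ^ b    ≡⟨ *-assoc (2 ^ c) (L ^ b) (2 ^ b) ⟩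
      2 ^ c * (L ^ b * 2 ^ b)  ≤⟨ *-monoʳ-≤ (2 ^ c) (go L₀≤′L) ⟩
      2 ^ c * 2 ^ (c * L)      ≡⟨ ^-distribˡ-+-* 2 c (c * L) ⟨
      2 ^ (c + c * L)          ≡⟨ cong (2 ^_) (*-suc c L) ⟨
      2 ^ (c * suc L)          ∎

  LogBelow-L*t : ∀ b c L t .{{_ : NonZero b}} .{{_ : NonZero L}} .{{_ : NonZero t}} →
                 t < 2 ^ suc L → L ^ b * 2 ^ b ≤ 2 ^ (c * L) → LogBelow (b + c) b t (L * t)
  LogBelow-L*t b c L t t<2ᴸ⁺¹ L^b*2^b≤2^cL = begin-strict
    (L * t) ^ (t * b)          ≡⟨ cong ((L * t) ^_) (*-comm t b) ⟩
    (L * t) ^ (b * t)          ≡⟨ ^-*-assoc (L * t) b t ⟨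
    ((L * t) ^ b) ^ t          <⟨ ^-monoˡ-< t [Lt]^b<2^[[b+c]L] ⟩
    (2 ^ ((b + c) * L)) ^ t    ≡⟨ ^-*-assoc 2 ((b + c) * L) t ⟩
    2 ^ ((b + c) * L * t)      ≡⟨ cong (2 ^_) (*-assoc (b + c) L t) ⟩
    2 ^ ((b + c) * (L * t))    ∎
    where
    open ≤-Reasoning
    exponent : ∀ b c L → c * L + L * b ≡ (b + c) * L
    exponent = solve-∀
    [Lt]^b<2^[[b+c]L] : (L * t) ^ b < 2 ^ ((b + c) * L)
    [Lt]^b<2^[[b+c]L] = begin-strict
      (L * t) ^ b                    <⟨ ^-monoˡ-< b (*-monoʳ-< L t<2ᴸ⁺¹) ⟩
      (L * 2 ^ suc L) ^ b            ≡⟨ ^-distribʳ-* L (2 ^ suc L) b ⟩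
      L ^ b * (2 ^ suc L) ^ b        ≡⟨ cong (L ^ b *_) (^-*-assoc 2 (suc L) b) ⟩
      L ^ b * 2 ^ (b + L * b)        ≡⟨ cong (L ^ b *_) (^-distribˡ-+-* 2 b (L * b)) ⟩
      L ^ b * (2 ^ b * 2 ^ (L * b))  ≡⟨ *-assoc (L ^ b) (2 ^ b) (2 ^ (L * b)) ⟨
      L ^ b * 2 ^ b * 2 ^ (L * b)    ≤⟨ *-monoˡ-≤ (2 ^ (L * b)) L^b*2^b≤2^cL ⟩
      2 ^ (c * L) * 2 ^ (L * b)      ≡⟨ ^-distribˡ-+-* 2 (c * L) (L * b) ⟨
      2 ^ (c * L + L * b)            ≡⟨ cong (2 ^_) (exponent b c L) ⟩
      2 ^ ((b + c) * L)              ∎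

  LogBelow-large : ∀ {n t} → 2 ^ 13 ≤ t → Admissible n t → LogBelow 547 400 t n
  LogBelow-large {n} {t@(suc t′)} 2¹³≤t adm with L , 2ᴸ≤t , t<2ᴸ⁺¹ ← log₂-bracket t′ =
    LogBelow-mono (≤ᵇ⇒≤ 400 547 tt) (*-monoˡ-≤ t (≤-trans (s≤s (s≤s z≤n)) 13≤L))
      (admissible⇒L*t≤n {L = L} 2ᴸ≤t adm)
      (LogBelow-L*t 400 147 L t t<2ᴸ⁺¹
        (L^b*2^b≤2^[c*L] 400 147 13 (≤ᵇ⇒≤ _ _ tt) (≤ᵇ⇒≤ _ _ tt) 13≤L))
    where
    13≤L : 13 ≤ L
    13≤L with 13 ≤? L
    ... | yes 13≤L = 13≤L
    ... | no  13≰L = contradiction (≤-trans (^-monoʳ-≤ 2 (≰⇒> 13≰L)) 2¹³≤t) (<⇒≱ t<2ᴸ⁺¹)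
    instance
      L≢0 : NonZero L
      L≢0 = >-nonZero (≤-trans (s≤s z≤n) 13≤L)

  lowerBound : ℕ → ℕ → ℕ
  lowerBound t k = (2 ^ e * ((k + 2) * t) ∸ 11356 + mersenne e) / suc (mersenne e) ⊔ 2
    where e = 13 ∸ k

  Forces : ℕ → ℕ → ℕ → Set
  Forces t k m = m ≤ 2 ⊎ 2 ^ (13 ∸ k) * (m ∸ 1) + 11356 < 2 ^ (13 ∸ k) * ((k + 2) * t)

  Certifies : ℕ → ℕ → ℕ → Set
  Certifies t m D = m ^ suc D ≤ 2 ^ E × 400 * t * E < 547 * m * suc D
    where E = (547 * m * suc D ∸ 1) / suc (400 * t ∸ 1)

  -- For t < 2¹³: at the level 14 = e + k + 1 with e = 13 − k, the bound R ≤ 11356 forces n ≥ m for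
  -- m = lowerBound t k, and at m the exponents D + 1 and E certify log₂ m ≤ E / (D + 1) < 547 m / (400 t).
  SmallCertificate : ℕ → Set
  SmallCertificate t = ∃ λ k → k < 14 ×
    Forces t k (lowerBound t k) × 2 * t ≤ lowerBound t k × ∃ λ D → D < 20 × Certifies t (lowerBound t k) D

  smallCertificate? : ∀ t → Dec (SmallCertificate t)
  smallCertificate? t = anyUpTo? (λ k → forces? k ×-dec 2 * t ≤? lowerBound t k ×-dec certified? k) 14
    where
    forces? : ∀ k → Dec (Forces t k (lowerBound t k))
    forces? k = lowerBound t k ≤? 2 ⊎-dec _ <? _
    certifies? : ∀ m D → Dec (Certifies t m D)
    certifies? m D = _ ≤? _ ×-dec _ <? _
    certified? : ∀ k → Dec (∃ λ D → D < 20 × Certifies t (lowerBound t k) D)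
    certified? k = anyUpTo? (certifies? (lowerBound t k)) 20

  smallCertificates : ∀ {t} → t < 2 ^ 13 → SmallCertificate t
  smallCertificates = invert (subst (Reflects _) checked (proof decision))
    where
    decision = allUpTo? smallCertificate? (2 ^ 13)
    checked : does decision ≡ true
    checked = refl

  SmallCertificate-sound : ∀ {n t} → SmallCertificate t → 2 ≤ n → Admissible n t → LogBelow 547 400 t n
  SmallCertificate-sound {n} {t} (k , k<14 , forces , 2t≤m , D , _ , mᴰ≤2ᴱ , btE<amD) 2≤n adm =
    LogBelow-mono {t = t} {m = m} (≤ᵇ⇒≤ 400 547 tt) 2t≤m m≤n
      (LogBelow-certificate {547} {400} {t} {m} (suc D) _ mᴰ≤2ᴱ btE<amD)
    where
    m = lowerBound t k
    e = 13 ∸ k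
    R≤11356 : ∀ R → (2 ^ suc (e + k)) ^ R ≤ 2 * mersenne (suc (e + k)) ^ R → R ≤ 11356
    R≤11356 R halving = [2^14]^R≤2*mersenne[14]^R⇒R≤11356 R
      (subst (λ K → (2 ^ suc K) ^ R ≤ 2 * mersenne (suc K) ^ R) (m∸n+n≡m (m<1+n⇒m≤n k<14)) halving)
    linear : 2 ^ e * ((k + 2) * t) ≤ 2 ^ e * n + 11356
    linear with R , halving , bound ← adm k e = ≤-trans bound (+-monoʳ-≤ (2 ^ e * n) (R≤11356 R halving))
    m≤n : m ≤ n
    m≤n = [ (λ m≤2 → ≤-trans m≤2 2≤n)
          , (λ gap → ≤-trans (m≤n+m∸n m 1) (*-cancelˡ-< (2 ^ e) (m ∸ 1) n
              (+-cancelʳ-< 11356 (2 ^ e * (m ∸ 1)) (2 ^ e * n) (<-≤-trans gap linear))))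
          ]′ forces

  LogBelow-admissible : ∀ {n t} → 2 ≤ n → Admissible n t → LogBelow 547 400 t n
  LogBelow-admissible {n} {t} 2≤n adm with t <? 2 ^ 13
  ... | yes small = SmallCertificate-sound (smallCertificates small) 2≤n adm
  ... | no  large = LogBelow-large (≮⇒≥ large) adm

  -- 547 / 400 < 1 + e⁻¹ because e < 400 / 147, which eLess witnesses at N = 5.
  BelowThreshold-LogBelow : ∀ {n t} → 0 < n → LogBelow 547 400 t n → BelowThreshold n t
  BelowThreshold-LogBelow {n} {t} 0<n below = 547 * n , 400 , z<s , below , inj₂ (400n<547n , e<400/147)
    where
    instance
      n≢0 : NonZero n
      n≢0 = >-nonZero 0<n
    400n<547n : 400 * n < 547 * n
    400n<547n = *-monoˡ-< n (≤ᵇ⇒≤ 401 547 tt)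
    pull : ∀ c n x → c * n * x ≡ n * (c * x)
    pull = solve-∀
    e<400/147 : eLess (400 * n) (547 * n ∸ 400 * n)
    e<400/147 = 5 , subst (λ q → q * (6 * P 5 + 2) < 400 * n * 6 !) (*-distribʳ-∸ n 547 400) (begin-strict
      147 * n * (6 * P 5 + 2)  ≡⟨ pull 147 n (6 * P 5 + 2) ⟩
      n * (147 * (6 * P 5 + 2)) <⟨ *-monoʳ-< n (<ᵇ⇒< _ _ tt) ⟩
      n * (400 * 6 !)          ≡⟨ pull 400 n (6 !) ⟨
      400 * n * 6 !            ∎)
      where open ≤-Reasoning

-- Opened only now: Data.Fin's _<_ would clash with Data.Nat's in the modules above.
open import Data.Nat using (ℕ; _≤_; _∸_; _^_)
open import Data.Fin using (Fin; _<_)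
open import Data.Fin.Subset using (Subset; _∩_; Nonempty)
open import Data.Product using (Σ; _×_)
open import Data.List.Membership.Propositional using (_∈_)

open import Data.Nat using (suc; z<s)
open import Data.Fin.Properties using (any?; _<?_)
open import Data.Fin.Subset.Properties using (nonempty?)
open import Data.List using (tabulate)
open import Data.List.Properties using (length-map; length-tabulate)
open import Data.List.Membership.Propositional.Properties using (∈-tabulate⁻)
open import Data.List.Relation.Unary.AllPairs.Properties using (tabulate⁺-<)
open import Data.Product using (_,_)
open import Relation.Binary.PropositionalEquality using (refl; subst; trans)
open import Relation.Nullary using (yes; no; contradiction)
open import Relation.Nullary.Decidable using (_×-dec_)
open Weights using (Admissible; admissible)
open UpClosure using (PairwiseDisjoint; sizes; sum-sizes≤n; mersenne-product-bound)
open LogBound using (LogBelow-admissible; BelowThreshold-LogBelow)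

theorem3p11 : (n : ℕ) → 2 ≤ n → (𝒰 : Family n) → IsUpSet 𝒰 → card 𝒰 ≤ 2 ^ (n ∸ 1) →
    (t : ℕ) → AboveThreshold n t →
    (A : Fin t → Subset n) → (∀ i → A i ∈ members 𝒰) →
    Σ (Fin t) λ i → Σ (Fin t) λ j → (i < j) × Nonempty (A i ∩ A j)
theorem3p11 n@(suc _) 2≤n 𝒰 up-set card≤ t above A A∈𝒰
  with any? (λ i → any? (λ j → i <? j ×-dec nonempty? (A i ∩ A j)))
... | yes intersecting = intersecting
... | no  disjoint     =
  contradiction (BelowThreshold-LogBelow {t = t} z<s (LogBelow-admissible 2≤n admissible-t)) above
  where
  xs = tabulate A
  #xs : PairwiseDisjoint xs
  #xs = tabulate⁺-< λ {i} {j} i<j nonempty → disjoint (i , j , i<j , nonempty)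
  xs⊆𝒰 : ∀ {B} → B ∈ xs → B ∈ members 𝒰
  xs⊆𝒰 B∈xs with i , refl ← ∈-tabulate⁻ B∈xs = A∈𝒰 i
  admissible-t : Admissible n t
  admissible-t = subst (Admissible n) (trans (length-map _ xs) (length-tabulate A))
    (admissible (sizes xs) (sum-sizes≤n xs #xs) (mersenne-product-bound 𝒰 up-set card≤ xs #xs xs⊆𝒰))
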